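{- Let $p$ be an odd prime and $e\ge1$ an integer. Then $$\sum_{k=1}^{p-1}\binom{p^e-1}{k}^{ -1}\equiv p^{e-1}(1-2^{p-1})\pmod{p^{e+1}}.$$
   Context: For rationals $a,b$, $a\equiv b\pmod{p^m}$ means $\nu_p(a-b)\ge m$ (or $a=b$), where $\nu_p$ is the exponent of $p$. -}

module Defs where

open import Data.Nat using (ℕ; zero; suc; _^_; _∸_)
open import Data.Nat.Divisibility using (_∣_)
open import Data.Integer using (ℤ; ∣_∣; +_)
open import Data.Rational using (ℚ; _+_; _-_; 0ℚ; ↥_; _/_)
open import Data.Nat.Combinatorics using (_C_)
open import Relation.Binary.PropositionalEquality using (_≡_)
open import Data.Sum using (_⊎_)

-- reciprocal of a natural number as a rational; 0 ↦ 0 (junk value, never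
-- used below since the binomial coefficients involved are nonzero)
recipℕ : ℕ → ℚ
recipℕ zero = 0ℚ
recipℕ (suc n) = (+ 1) / suc n

sumFrom1 : ℕ → (ℕ → ℚ) → ℚ
sumFrom1 zero f = 0ℚ
sumFrom1 (suc n) f = sumFrom1 n f + f (suc n)

-- a ≡ b (mod p^m) for rationals: ν_p(a - b) ≥ m or a = b.
-- Since ℚ is stored in lowest terms, ν_p(a - b) ≥ m (m ≥ 0) is exactly
-- p^m dividing the numerator of a - b.
_≡_[modℚ_^_] : ℚ → ℚ → ℕ → ℕ → Set
a ≡ b [modℚ p ^ m ] = (a ≡ b) ⊎ ((p ^ m) ∣ ∣ ↥ (a - b) ∣)

{-# OPTIONS --safe #-}
module Submission where

-- Put q = p^e and u_k = 1/C(q-1,k). Since u_{k+1} = u_k (k+1)/(q-k-1) and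
-- (k+1)/(q-k-1) ≡ -(1 + q/(k+1)) mod q², induction on k < p gives
-- u_k ≡ (-1)^k (1 + q H_k) mod p^{2e}, where H_k is the k-th harmonic number.
-- For q = p, inverting yields C(p-1,k) ≡ (-1)^k (1 - p H_k) mod p².
-- As p - 1 is even, Σ_{k=1}^{p-1} (-1)^k (1 + c H_k) = c T with
-- T = Σ_{k=1}^{p-1} (-1)^k H_k, so summing the two congruences gives
-- Σ u_k ≡ q T mod p^{e+1} and 2^{p-1} - 1 ≡ -p T mod p²; eliminating T
-- gives the claim.

open import Defs
open import Level using (0ℓ)
open import Function using (_∘_)
open import Data.Product using (∃-syntax; _,_)
open import Data.Sum using (inj₁; inj₂)
open import Data.Nat as ℕ using (ℕ; zero; suc; _^_; _∸_; _≤_; _<_; z≤n; s≤s; NonZero)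
import Data.Nat.Properties as ℕ
import Data.Nat.Tactic.RingSolver as ℕ-Solver
open import Data.Nat.Divisibility
  using (_∣_; _∤_; divides; ∣-refl; ∣-reflexive; ∣-trans; ∣⇒≤; _∣0; 1∣_; ∣m+n∣m⇒∣n; m∣m*n; n∣m*n; *-monoˡ-∣; *-cancelʳ-∣; >⇒∤)
open import Data.Nat.DivMod using (_%_; _/_; m%n<n; m≡m%n+[m/n]*n)
open import Data.Nat.Coprimality using (1-coprimeTo) renaming (sym to coprime-sym)
open import Data.Nat.Primality using (Prime; composite; euclidsLemma; prime⇒nonZero; prime⇒nonTrivial)
open import Data.Nat.Combinatorics using (_C_; nCk+nC[k+1]≡[n+1]C[k+1]; nC1≡n; k>n⇒nCk≡0)
open import Data.Integer as ℤ using (ℤ; +_; ∣_∣)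
import Data.Integer.Properties as ℤ
import Data.Integer.Divisibility.Signed as ℤ∣
open import Data.Rational using (ℚ; mkℚ; ↥_; ↧_; ↧ₙ_; _+_; _*_; -_; _-_; 0ℚ; 1ℚ; toℚᵘ)
open import Data.Rational using () renaming (_/_ to _//_)
import Data.Rational.Properties as ℚ
open import Data.Rational.Properties
  using (+-*-commutativeRing; _≟_; normalize-coprime; toℚᵘ-injective; toℚᵘ-homo-+; toℚᵘ-homo-*; ↥-+; ↧-+; ↥-*; ↧-*; ↥-neg; ↧-neg)
import Data.Rational.Unnormalised as ℚᵘ
import Data.Rational.Unnormalised.Properties as ℚᵘ
open import Relation.Binary.PropositionalEquality hiding (J)
open import Relation.Nullary using (contradiction)
open import Relation.Nullary.Decidable using (dec⇒maybe)
open import Tactic.RingSolver using (solve-∀)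
import Tactic.RingSolver.Core.AlmostCommutativeRing as ACR

ℚ-ring : ACR.AlmostCommutativeRing 0ℓ 0ℓ
ℚ-ring = ACR.fromCommutativeRing +-*-commutativeRing (dec⇒maybe ∘ (0ℚ ≟_))

fromℕ : ℕ → ℚ
fromℕ n = + n // 1

fromℕ≡mkℚ : ∀ n → fromℕ n ≡ mkℚ (+ n) 0 (coprime-sym (1-coprimeTo n))
fromℕ≡mkℚ n = normalize-coprime (coprime-sym (1-coprimeTo n))

recipℕ≡mkℚ : ∀ n → recipℕ (suc n) ≡ mkℚ (+ 1) n (1-coprimeTo (suc n))
recipℕ≡mkℚ n = normalize-coprime (1-coprimeTo (suc n))

toℚᵘ-fromℕ : ∀ n → toℚᵘ (fromℕ n) ≡ ℚᵘ.mkℚᵘ (+ n) 0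
toℚᵘ-fromℕ n = cong toℚᵘ (fromℕ≡mkℚ n)

fromℕ-+ : ∀ m n → fromℕ (m ℕ.+ n) ≡ fromℕ m + fromℕ n
fromℕ-+ m n = toℚᵘ-injective (begin
  toℚᵘ (fromℕ (m ℕ.+ n))                ≡⟨ toℚᵘ-fromℕ (m ℕ.+ n) ⟩
  ℚᵘ.mkℚᵘ (+ (m ℕ.+ n)) 0                ≈⟨ ℚᵘ.*≡* (cong (ℤ._* + 1) +[m+n]≡+m*1++n*1) ⟩
  ℚᵘ.mkℚᵘ (+ m) 0 ℚᵘ.+ ℚᵘ.mkℚᵘ (+ n) 0   ≡⟨ cong₂ ℚᵘ._+_ (toℚᵘ-fromℕ m) (toℚᵘ-fromℕ n) ⟨
  toℚᵘ (fromℕ m) ℚᵘ.+ toℚᵘ (fromℕ n)     ≈⟨ toℚᵘ-homo-+ (fromℕ m) (fromℕ n) ⟨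
  toℚᵘ (fromℕ m + fromℕ n)              ∎)
  where
  open ℚᵘ.≃-Reasoning
  +[m+n]≡+m*1++n*1 : + (m ℕ.+ n) ≡ + m ℤ.* + 1 ℤ.+ + n ℤ.* + 1
  +[m+n]≡+m*1++n*1 = trans (ℤ.pos-+ m n) (sym (cong₂ ℤ._+_ (ℤ.*-identityʳ (+ m)) (ℤ.*-identityʳ (+ n))))

fromℕ-* : ∀ m n → fromℕ (m ℕ.* n) ≡ fromℕ m * fromℕ n
fromℕ-* m n = toℚᵘ-injective (begin
  toℚᵘ (fromℕ (m ℕ.* n))                ≡⟨ toℚᵘ-fromℕ (m ℕ.* n) ⟩
  ℚᵘ.mkℚᵘ (+ (m ℕ.* n)) 0                ≈⟨ ℚᵘ.*≡* (cong (ℤ._* + 1) (ℤ.pos-* m n)) ⟩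
  ℚᵘ.mkℚᵘ (+ m) 0 ℚᵘ.* ℚᵘ.mkℚᵘ (+ n) 0   ≡⟨ cong₂ ℚᵘ._*_ (toℚᵘ-fromℕ m) (toℚᵘ-fromℕ n) ⟨
  toℚᵘ (fromℕ m) ℚᵘ.* toℚᵘ (fromℕ n)     ≈⟨ toℚᵘ-homo-* (fromℕ m) (fromℕ n) ⟨
  toℚᵘ (fromℕ m * fromℕ n)              ∎)
  where open ℚᵘ.≃-Reasoning

fromℕ-∸ : ∀ {m n} → n ≤ m → fromℕ (m ∸ n) ≡ fromℕ m - fromℕ n
fromℕ-∸ {m} {n} n≤m = begin
  fromℕ (m ∸ n)                        ≡⟨ add-sub (fromℕ (m ∸ n)) (fromℕ n) ⟩
  (fromℕ (m ∸ n) + fromℕ n) - fromℕ n  ≡⟨ cong (_- fromℕ n) (fromℕ-+ (m ∸ n) n) ⟨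
  fromℕ (m ∸ n ℕ.+ n) - fromℕ n        ≡⟨ cong (λ k → fromℕ k - fromℕ n) (ℕ.m∸n+n≡m n≤m) ⟩
  fromℕ m - fromℕ n                    ∎
  where
  open ≡-Reasoning
  add-sub : ∀ x y → x ≡ (x + y) - y
  add-sub = solve-∀ ℚ-ring

recipℕ-inverseˡ : ∀ n .{{_ : NonZero n}} → recipℕ n * fromℕ n ≡ 1ℚ
recipℕ-inverseˡ (suc n) = toℚᵘ-injective (begin
  toℚᵘ (recipℕ (suc n) * fromℕ (suc n))            ≈⟨ toℚᵘ-homo-* (recipℕ (suc n)) (fromℕ (suc n)) ⟩
  toℚᵘ (recipℕ (suc n)) ℚᵘ.* toℚᵘ (fromℕ (suc n))  ≡⟨ cong₂ ℚᵘ._*_ (cong toℚᵘ (recipℕ≡mkℚ n)) (toℚᵘ-fromℕ (suc n)) ⟩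
  ℚᵘ.mkℚᵘ (+ 1) n ℚᵘ.* ℚᵘ.mkℚᵘ (+ suc n) 0         ≈⟨ ℚᵘ.*≡* (trans (ℤ.*-identityʳ _) (trans (ℤ.*-identityˡ _) (sym (trans (ℤ.*-identityˡ _) (cong +_ (ℕ.*-identityʳ (suc n))))))) ⟩
  ℚᵘ.1ℚᵘ                                           ∎)
  where open ℚᵘ.≃-Reasoning

recipℕ-cross : ∀ a b c d .{{_ : NonZero a}} .{{_ : NonZero c}} .{{_ : NonZero d}} →
               a ℕ.* b ≡ c ℕ.* d → recipℕ a ≡ fromℕ b * recipℕ c * recipℕ d
recipℕ-cross a b c d ab≡cd = begin
  recipℕ a                                                ≡⟨ pad (recipℕ a) ⟩
  recipℕ a * 1ℚ * 1ℚ                                      ≡⟨ cong₂ (λ x y → recipℕ a * x * y) (recipℕ-inverseˡ c) (recipℕ-inverseˡ d) ⟨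
  recipℕ a * (recipℕ c * fromℕ c) * (recipℕ d * fromℕ d)  ≡⟨ regroup (recipℕ a) (recipℕ c) (fromℕ c) (recipℕ d) (fromℕ d) ⟩
  recipℕ a * (fromℕ c * fromℕ d) * recipℕ c * recipℕ d    ≡⟨ cong (λ x → recipℕ a * x * recipℕ c * recipℕ d) fromℕ[ab]≡fromℕ[cd] ⟨
  recipℕ a * (fromℕ a * fromℕ b) * recipℕ c * recipℕ d    ≡⟨ regroup′ (recipℕ a) (fromℕ a) (fromℕ b) (recipℕ c) (recipℕ d) ⟩
  recipℕ a * fromℕ a * fromℕ b * recipℕ c * recipℕ d      ≡⟨ cong (λ x → x * fromℕ b * recipℕ c * recipℕ d) (recipℕ-inverseˡ a) ⟩
  1ℚ * fromℕ b * recipℕ c * recipℕ d                      ≡⟨ unpad (fromℕ b) (recipℕ c) (recipℕ d) ⟩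
  fromℕ b * recipℕ c * recipℕ d                           ∎
  where
  open ≡-Reasoning
  fromℕ[ab]≡fromℕ[cd] : fromℕ a * fromℕ b ≡ fromℕ c * fromℕ d
  fromℕ[ab]≡fromℕ[cd] = trans (sym (fromℕ-* a b)) (trans (cong fromℕ ab≡cd) (fromℕ-* c d))
  pad : ∀ x → x ≡ x * 1ℚ * 1ℚ
  pad = solve-∀ ℚ-ring
  unpad : ∀ x y z → 1ℚ * x * y * z ≡ x * y * z
  unpad = solve-∀ ℚ-ring
  regroup : ∀ a c c′ d d′ → a * (c * c′) * (d * d′) ≡ a * (c′ * d′) * c * d
  regroup = solve-∀ ℚ-ring
  regroup′ : ∀ a a′ b c d → a * (a′ * b) * c * d ≡ a * a′ * b * c * d
  regroup′ = solve-∀ ℚ-ring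

[k+1]*nC[k+1]+k*nCk≡n*nCk : ∀ n k → suc k ℕ.* (n C suc k) ℕ.+ k ℕ.* (n C k) ≡ n ℕ.* (n C k)
[k+1]*nC[k+1]+k*nCk≡n*nCk zero    zero    = refl
[k+1]*nC[k+1]+k*nCk≡n*nCk zero    (suc k) = cong₂ ℕ._+_ (ℕ.*-zeroʳ (suc (suc k))) (ℕ.*-zeroʳ (suc k))
[k+1]*nC[k+1]+k*nCk≡n*nCk (suc n) zero    =
  trans (ℕ.+-identityʳ _) (trans (ℕ.+-identityʳ _) (trans (nC1≡n (suc n)) (sym (ℕ.*-identityʳ (suc n)))))
[k+1]*nC[k+1]+k*nCk≡n*nCk (suc n) (suc k) = begin
  suc (suc k) ℕ.* (suc n C suc (suc k)) ℕ.+ suc k ℕ.* (suc n C suc k)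
    ≡⟨ cong₂ (λ x y → suc (suc k) ℕ.* x ℕ.+ suc k ℕ.* y) (pascal (suc k)) (pascal k) ⟩
  suc (suc k) ℕ.* (b ℕ.+ c) ℕ.+ suc k ℕ.* (a ℕ.+ b)
    ≡⟨ regroup k a b c ⟩
  (suc (suc k) ℕ.* c ℕ.+ suc k ℕ.* b) ℕ.+ (suc k ℕ.* b ℕ.+ k ℕ.* a) ℕ.+ (a ℕ.+ b)
    ≡⟨ cong₂ (λ x y → x ℕ.+ y ℕ.+ (a ℕ.+ b)) ([k+1]*nC[k+1]+k*nCk≡n*nCk n (suc k)) ([k+1]*nC[k+1]+k*nCk≡n*nCk n k) ⟩
  n ℕ.* b ℕ.+ n ℕ.* a ℕ.+ (a ℕ.+ b)
    ≡⟨ collect n a b ⟩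
  suc n ℕ.* (a ℕ.+ b)
    ≡⟨ cong (suc n ℕ.*_) (pascal k) ⟨
  suc n ℕ.* (suc n C suc k) ∎
  where
  open ≡-Reasoning
  a = n C k
  b = n C suc k
  c = n C suc (suc k)
  pascal : ∀ i → suc n C suc i ≡ n C i ℕ.+ n C suc i
  pascal i = sym (nCk+nC[k+1]≡[n+1]C[k+1] n i)
  regroup : ∀ k a b c → suc (suc k) ℕ.* (b ℕ.+ c) ℕ.+ suc k ℕ.* (a ℕ.+ b)
                      ≡ (suc (suc k) ℕ.* c ℕ.+ suc k ℕ.* b) ℕ.+ (suc k ℕ.* b ℕ.+ k ℕ.* a) ℕ.+ (a ℕ.+ b)
  regroup = ℕ-Solver.solve-∀
  collect : ∀ n a b → n ℕ.* b ℕ.+ n ℕ.* a ℕ.+ (a ℕ.+ b) ≡ suc n ℕ.* (a ℕ.+ b)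
  collect = ℕ-Solver.solve-∀

nC[k+1]*[k+1]≡[n∸k]*nCk : ∀ n k → (n C suc k) ℕ.* suc k ≡ (n ∸ k) ℕ.* (n C k)
nC[k+1]*[k+1]≡[n∸k]*nCk n k = begin
  (n C suc k) ℕ.* suc k                                      ≡⟨ ℕ.*-comm (n C suc k) (suc k) ⟩
  suc k ℕ.* (n C suc k)                                      ≡⟨ ℕ.m+n∸n≡m _ (k ℕ.* (n C k)) ⟨
  (suc k ℕ.* (n C suc k) ℕ.+ k ℕ.* (n C k)) ∸ k ℕ.* (n C k)  ≡⟨ cong (_∸ k ℕ.* (n C k)) ([k+1]*nC[k+1]+k*nCk≡n*nCk n k) ⟩
  n ℕ.* (n C k) ∸ k ℕ.* (n C k)                              ≡⟨ ℕ.*-distribʳ-∸ (n C k) n k ⟨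
  (n ∸ k) ℕ.* (n C k)                                        ∎
  where open ≡-Reasoning

nCk>0 : ∀ {n k} → k ≤ n → 0 < n C k
nCk>0 {n}     {zero}  _         = s≤s z≤n
nCk>0 {suc n} {suc k} (s≤s k≤n) =
  subst (0 <_) (nCk+nC[k+1]≡[n+1]C[k+1] n k) (ℕ.<-≤-trans (nCk>0 k≤n) (ℕ.m≤m+n _ _))

1/C[n,k+1]≡[k+1]/[n∸k]*1/C[n,k] : ∀ {n k} → k < n → recipℕ (n C suc k) ≡ fromℕ (suc k) * recipℕ (n ∸ k) * recipℕ (n C k)
1/C[n,k+1]≡[k+1]/[n∸k]*1/C[n,k] {n} {k} k<n = recipℕ-cross (n C suc k) (suc k) (n ∸ k) (n C k) (nC[k+1]*[k+1]≡[n∸k]*nCk n k)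
  where
  instance
    C[n,k+1]≢0 : NonZero (n C suc k)
    C[n,k+1]≢0 = ℕ.>-nonZero (nCk>0 k<n)
    n∸k≢0 : NonZero (n ∸ k)
    n∸k≢0 = ℕ.>-nonZero (ℕ.m<n⇒0<n∸m k<n)
    C[n,k]≢0 : NonZero (n C k)
    C[n,k]≢0 = ℕ.>-nonZero (nCk>0 (ℕ.<⇒≤ k<n))

m^n∣m^o : ∀ m {n o} → n ≤ o → m ^ n ∣ m ^ o
m^n∣m^o m {n} {o} n≤o = divides (m ^ (o ∸ n)) (trans (cong (m ^_) (sym (ℕ.m∸n+n≡m n≤o))) (ℕ.^-distribˡ-+-* m (o ∸ n) n))

fromℕ-pascal : ∀ n k → fromℕ (suc n C suc k) ≡ fromℕ (n C k) + fromℕ (n C suc k)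
fromℕ-pascal n k = trans (cong fromℕ (sym (nCk+nC[k+1]≡[n+1]C[k+1] n k))) (fromℕ-+ (n C k) (n C suc k))

binomialPrefix : ℕ → ℕ → ℚ
binomialPrefix n j = 1ℚ + sumFrom1 j (λ k → fromℕ (n C k))

binomialPrefix-pascal : ∀ n j → binomialPrefix (suc n) (suc j) ≡ binomialPrefix n j + binomialPrefix n (suc j)
binomialPrefix-pascal n zero = begin
  1ℚ + (0ℚ + fromℕ (suc n C 1))            ≡⟨ cong (λ z → 1ℚ + (0ℚ + z)) (fromℕ-pascal n 0) ⟩
  1ℚ + (0ℚ + (1ℚ + fromℕ (n C 1)))         ≡⟨ regroup (fromℕ (n C 1)) ⟩
  (1ℚ + 0ℚ) + (1ℚ + (0ℚ + fromℕ (n C 1)))  ∎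
  where
  open ≡-Reasoning
  regroup : ∀ x → 1ℚ + (0ℚ + (1ℚ + x)) ≡ (1ℚ + 0ℚ) + (1ℚ + (0ℚ + x))
  regroup = solve-∀ ℚ-ring
binomialPrefix-pascal n (suc j) = begin
  1ℚ + (sumFrom1 (suc j) (λ k → fromℕ (suc n C k)) + fromℕ (suc n C suc (suc j)))
    ≡⟨ ℚ.+-assoc 1ℚ (sumFrom1 (suc j) (λ k → fromℕ (suc n C k))) (fromℕ (suc n C suc (suc j))) ⟨
  binomialPrefix (suc n) (suc j) + fromℕ (suc n C suc (suc j))
    ≡⟨ cong₂ _+_ (binomialPrefix-pascal n j) (fromℕ-pascal n (suc j)) ⟩
  (binomialPrefix n j + binomialPrefix n (suc j)) + (fromℕ (n C suc j) + fromℕ (n C suc (suc j)))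
    ≡⟨ regroup (sumFrom1 j (λ k → fromℕ (n C k))) (fromℕ (n C suc j)) (fromℕ (n C suc (suc j))) ⟩
  binomialPrefix n (suc j) + binomialPrefix n (suc (suc j)) ∎
  where
  open ≡-Reasoning
  regroup : ∀ s x y → ((1ℚ + s) + (1ℚ + (s + x))) + (x + y) ≡ (1ℚ + (s + x)) + (1ℚ + ((s + x) + y))
  regroup = solve-∀ ℚ-ring

binomialPrefix-overshoot : ∀ n → binomialPrefix n (suc n) ≡ binomialPrefix n n
binomialPrefix-overshoot n = cong (_+_ 1ℚ) (begin
  sumFrom1 n (λ k → fromℕ (n C k)) + fromℕ (n C suc n)  ≡⟨ cong (λ c → sumFrom1 n (λ k → fromℕ (n C k)) + fromℕ c) (k>n⇒nCk≡0 (ℕ.n<1+n n)) ⟩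
  sumFrom1 n (λ k → fromℕ (n C k)) + 0ℚ                 ≡⟨ ℚ.+-identityʳ _ ⟩
  sumFrom1 n (λ k → fromℕ (n C k))                      ∎)
  where open ≡-Reasoning

binomialPrefix[n,n]≡2^n : ∀ n → binomialPrefix n n ≡ fromℕ (2 ^ n)
binomialPrefix[n,n]≡2^n zero    = refl
binomialPrefix[n,n]≡2^n (suc n) = begin
  binomialPrefix (suc n) (suc n)                 ≡⟨ binomialPrefix-pascal n n ⟩
  binomialPrefix n n + binomialPrefix n (suc n)  ≡⟨ cong (_+_ (binomialPrefix n n)) (binomialPrefix-overshoot n) ⟩
  binomialPrefix n n + binomialPrefix n n        ≡⟨ cong₂ _+_ (binomialPrefix[n,n]≡2^n n) (binomialPrefix[n,n]≡2^n n) ⟩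
  fromℕ (2 ^ n) + fromℕ (2 ^ n)                  ≡⟨ fromℕ-+ (2 ^ n) (2 ^ n) ⟨
  fromℕ (2 ^ n ℕ.+ 2 ^ n)                        ≡⟨ cong (λ x → fromℕ (2 ^ n ℕ.+ x)) (ℕ.+-identityʳ (2 ^ n)) ⟨
  fromℕ (2 ^ suc n)                              ∎
  where open ≡-Reasoning

-1^_ : ℕ → ℚ
-1^ zero  = 1ℚ
-1^ suc k = - (-1^ k)

-1^k*-1^k≡1 : ∀ k → -1^ k * -1^ k ≡ 1ℚ
-1^k*-1^k≡1 zero    = refl
-1^k*-1^k≡1 (suc k) = trans (neg*neg (-1^ k)) (-1^k*-1^k≡1 k)
  where
  neg*neg : ∀ x → - x * - x ≡ x * x
  neg*neg = solve-∀ ℚ-ring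

harmonic : ℕ → ℚ
harmonic n = sumFrom1 n recipℕ

sumFrom1-sub : ∀ n f g → sumFrom1 n f - sumFrom1 n g ≡ sumFrom1 n (λ k → f k - g k)
sumFrom1-sub zero    f g = refl
sumFrom1-sub (suc n) f g = trans (regroup (sumFrom1 n f) (f (suc n)) (sumFrom1 n g) (g (suc n)))
                                 (cong (_+ (f (suc n) - g (suc n))) (sumFrom1-sub n f g))
  where
  regroup : ∀ a x b y → (a + x) - (b + y) ≡ (a - b) + (x - y)
  regroup = solve-∀ ℚ-ring

sumFrom1-alternating : ∀ c (h : ℕ → ℚ) m →
  sumFrom1 (2 ℕ.* m) (λ k → -1^ k * (1ℚ + c * h k)) ≡ c * sumFrom1 (2 ℕ.* m) (λ k → -1^ k * h k)
sumFrom1-alternating c h zero    = sym (ℚ.*-zeroʳ c)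
sumFrom1-alternating c h (suc m) =
  subst (λ n → sumFrom1 n f ≡ c * sumFrom1 n g) (sym (ℕ.*-suc 2 m))
    (trans (cong (λ z → z + f (1 ℕ.+ 2 ℕ.* m) + f (2 ℕ.+ 2 ℕ.* m)) (sumFrom1-alternating c h m))
           (pair-cancels (sumFrom1 (2 ℕ.* m) g) c (-1^ (2 ℕ.* m)) (h (1 ℕ.+ 2 ℕ.* m)) (h (2 ℕ.+ 2 ℕ.* m))))
  where
  f g : ℕ → ℚ
  f k = -1^ k * (1ℚ + c * h k)
  g k = -1^ k * h k
  pair-cancels : ∀ t c s x y → c * t + - s * (1ℚ + c * x) + - - s * (1ℚ + c * y) ≡ c * (t + - s * x + - - s * y)
  pair-cancels = solve-∀ ℚ-ring

module PAdic {p : ℕ} (p-prime : Prime p) where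

  private instance
    p≢0 : NonZero p
    p≢0 = prime⇒nonZero p-prime

  p∤-* : ∀ {a b} → p ∤ a → p ∤ b → p ∤ a ℕ.* b
  p∤-* {a} {b} p∤a p∤b p∣ab with euclidsLemma a b p-prime p∣ab
  ... | inj₁ p∣a = p∤a p∣a
  ... | inj₂ p∣b = p∤b p∣b

  p∤-small : ∀ {j} → 0 < j → j < p → p ∤ j
  p∤-small {suc _} _ j<p = >⇒∤ j<p

  p∤1 : p ∤ 1
  p∤1 = p∤-small (s≤s z≤n) (ℕ.nonTrivial⇒n>1 p {{prime⇒nonTrivial p-prime}})

  pᵐ∣-cancelˡ : ∀ m {g a} → p ∤ g → p ^ m ∣ g ℕ.* a → p ^ m ∣ a
  pᵐ∣-cancelˡ zero            _   _       = 1∣ _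
  pᵐ∣-cancelˡ (suc m) {g} {a} p∤g pᵐ⁺¹∣ga with euclidsLemma g a p-prime (∣-trans (m∣m*n (p ^ m)) pᵐ⁺¹∣ga)
  ... | inj₁ p∣g              = contradiction p∣g p∤g
  ... | inj₂ (divides c refl) = subst (_∣ c ℕ.* p) (ℕ.*-comm (p ^ m) p) (*-monoˡ-∣ p pᵐ∣c)
    where
    pᵐ∣c : p ^ m ∣ c
    pᵐ∣c = pᵐ∣-cancelˡ m p∤g (*-cancelʳ-∣ p (subst₂ _∣_ (ℕ.*-comm p (p ^ m)) (sym (ℕ.*-assoc g c p)) pᵐ⁺¹∣ga))

  -- ν≥ m x says ν_p(x) ≥ m; as ℚ is kept in lowest terms, this is p ∤ ↧ x and p^m ∣ ↥ x.
  record ν≥ (m : ℕ) (x : ℚ) : Set where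
    constructor mkν≥
    field
      denominator-coprime : p ∤ ↧ₙ x
      numerator-divisible : + (p ^ m) ℤ∣.∣ ↥ x

  open ν≥ public

  -- The library describes ↥ and ↧ of x + y and x * y by the naive numerator a and
  -- denominator b, which are ↥ and ↧ scaled by a common factor g.
  ν≥-fraction : ∀ {m x} {a b g : ℤ} → ↥ x ℤ.* g ≡ a → ↧ x ℤ.* g ≡ b → p ∤ ∣ b ∣ → + (p ^ m) ℤ∣.∣ a → ν≥ m x
  ν≥-fraction {m} {x} {a} {b} {g} ↥x*g≡a ↧x*g≡b p∤b pᵐ∣a = mkν≥ p∤↧x (ℤ∣.∣ᵤ⇒∣ pᵐ∣↥x)
    where
    ∣b∣≡↧x*∣g∣ : ∣ b ∣ ≡ ↧ₙ x ℕ.* ∣ g ∣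
    ∣b∣≡↧x*∣g∣ = trans (cong ∣_∣ (sym ↧x*g≡b)) (ℤ.abs-* (↧ x) g)
    p∤↧x : p ∤ ↧ₙ x
    p∤↧x p∣↧x = p∤b (subst (p ∣_) (sym ∣b∣≡↧x*∣g∣) (∣-trans p∣↧x (m∣m*n ∣ g ∣)))
    p∤g : p ∤ ∣ g ∣
    p∤g p∣g = p∤b (subst (p ∣_) (sym ∣b∣≡↧x*∣g∣) (∣-trans p∣g (n∣m*n (↧ₙ x))))
    ∣a∣≡∣g∣*∣↥x∣ : ∣ a ∣ ≡ ∣ g ∣ ℕ.* ∣ ↥ x ∣
    ∣a∣≡∣g∣*∣↥x∣ = trans (cong ∣_∣ (sym ↥x*g≡a)) (trans (ℤ.abs-* (↥ x) g) (ℕ.*-comm ∣ ↥ x ∣ ∣ g ∣))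
    pᵐ∣↥x : p ^ m ∣ ∣ ↥ x ∣
    pᵐ∣↥x = pᵐ∣-cancelˡ m p∤g (subst (p ^ m ∣_) ∣a∣≡∣g∣*∣↥x∣ (ℤ∣.∣⇒∣ᵤ pᵐ∣a))

  ν≥-+ : ∀ {m x y} → ν≥ m x → ν≥ m y → ν≥ m (x + y)
  ν≥-+ {x = x} {y} (mkν≥ p∤↧x pᵐ∣↥x) (mkν≥ p∤↧y pᵐ∣↥y) =
    ν≥-fraction (↥-+ x y) (↧-+ x y)
      (subst (p ∤_) (sym (ℤ.abs-* (↧ x) (↧ y))) (p∤-* p∤↧x p∤↧y))
      (ℤ∣.∣m∣n⇒∣m+n (ℤ∣.∣m⇒∣m*n (↧ y) pᵐ∣↥x) (ℤ∣.∣m⇒∣m*n (↧ x) pᵐ∣↥y))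

  ν≥-* : ∀ {m n x y} → ν≥ m x → ν≥ n y → ν≥ (m ℕ.+ n) (x * y)
  ν≥-* {m} {n} {x} {y} (mkν≥ p∤↧x pᵐ∣↥x) (mkν≥ p∤↧y pⁿ∣↥y) =
    ν≥-fraction (↥-* x y) (↧-* x y)
      (subst (p ∤_) (sym (ℤ.abs-* (↧ x) (↧ y))) (p∤-* p∤↧x p∤↧y))
      (subst (ℤ∣._∣ ↥ x ℤ.* ↥ y) (trans (sym (ℤ.pos-* (p ^ m) (p ^ n))) (cong +_ (sym (ℕ.^-distribˡ-+-* p m n))))
        (ℤ∣.∣-trans (ℤ∣.*-monoˡ-∣ (+ (p ^ n)) pᵐ∣↥x) (ℤ∣.*-monoʳ-∣ (↥ x) pⁿ∣↥y)))

  ν≥-neg : ∀ {m x} → ν≥ m x → ν≥ m (- x)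
  ν≥-neg {x = x} (mkν≥ p∤↧x pᵐ∣↥x) =
    mkν≥ (subst (p ∤_) (cong ∣_∣ (sym (↧-neg x))) p∤↧x) (subst (ℤ∣._∣_ _) (sym (↥-neg x)) (ℤ∣.∣m⇒∣-m pᵐ∣↥x))

  ν≥-- : ∀ {m x y} → ν≥ m x → ν≥ m y → ν≥ m (x - y)
  ν≥-- νx νy = ν≥-+ νx (ν≥-neg νy)

  ν≥-weaken : ∀ {m n x} → n ≤ m → ν≥ m x → ν≥ n x
  ν≥-weaken n≤m (mkν≥ p∤↧x pᵐ∣↥x) = mkν≥ p∤↧x (ℤ∣.∣-trans (ℤ∣.∣ᵤ⇒∣ (m^n∣m^o p n≤m)) pᵐ∣↥x)

  ν≥-0ℚ : ∀ {m} → ν≥ m 0ℚ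
  ν≥-0ℚ {m} = mkν≥ p∤1 (ℤ∣.∣ᵤ⇒∣ (_∣0 (p ^ m)))

  ν≥-fromℕ : ∀ {m n} → p ^ m ∣ n → ν≥ m (fromℕ n)
  ν≥-fromℕ {m} {n} pᵐ∣n = subst (ν≥ m) (sym (fromℕ≡mkℚ n)) (mkν≥ p∤1 (ℤ∣.∣ᵤ⇒∣ pᵐ∣n))

  ν≥₀-fromℕ : ∀ n → ν≥ 0 (fromℕ n)
  ν≥₀-fromℕ n = ν≥-fromℕ (1∣ n)

  ν≥-recipℕ : ∀ {n} → p ∤ n → ν≥ 0 (recipℕ n)
  ν≥-recipℕ {zero}  _   = ν≥-0ℚ
  ν≥-recipℕ {suc n} p∤n = subst (ν≥ 0) (sym (recipℕ≡mkℚ n)) (mkν≥ p∤n (ℤ∣.∣ᵤ⇒∣ (1∣ 1)))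

  ν≥--1^ : ∀ k → ν≥ 0 (-1^ k)
  ν≥--1^ zero    = ν≥₀-fromℕ 1
  ν≥--1^ (suc k) = ν≥-neg (ν≥--1^ k)

  ν≥-sumFrom1 : ∀ {m} n f → (∀ k → 0 < k → k ≤ n → ν≥ m (f k)) → ν≥ m (sumFrom1 n f)
  ν≥-sumFrom1 zero    f νf = ν≥-0ℚ
  ν≥-sumFrom1 (suc n) f νf =
    ν≥-+ (ν≥-sumFrom1 n f (λ k 0<k k≤n → νf k 0<k (ℕ.m≤n⇒m≤1+n k≤n))) (νf (suc n) (s≤s z≤n) ℕ.≤-refl)

  ν≥-sumFrom1-sub : ∀ {m} n f g → (∀ k → 0 < k → k ≤ n → ν≥ m (f k - g k)) → ν≥ m (sumFrom1 n f - sumFrom1 n g)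
  ν≥-sumFrom1-sub n f g νf-g = subst (ν≥ _) (sym (sumFrom1-sub n f g)) (ν≥-sumFrom1 n (λ k → f k - g k) νf-g)

  ν≥-harmonic : ∀ {k} → k < p → ν≥ 0 (harmonic k)
  ν≥-harmonic {k} k<p = ν≥-sumFrom1 k recipℕ (λ j 0<j j≤k → ν≥-recipℕ (p∤-small 0<j (ℕ.≤-<-trans j≤k k<p)))

  module _ {q e : ℕ} .{{_ : NonZero q}} (pᵉ⁺¹∣q : p ^ suc e ∣ q) where

    private
      p∣q : p ∣ q
      p∣q = ∣-trans (m∣m*n (p ^ e)) pᵉ⁺¹∣q

      νq : ν≥ (suc e) (fromℕ q)
      νq = ν≥-fromℕ pᵉ⁺¹∣q

      j<q : ∀ {j} → j < p → j < q
      j<q j<p = ℕ.<-≤-trans j<p (∣⇒≤ p∣q)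

      p∤q∸j : ∀ {j} → 0 < j → j < p → p ∤ q ∸ j
      p∤q∸j 0<j j<p p∣q∸j =
        p∤-small 0<j j<p (∣m+n∣m⇒∣n (subst (p ∣_) (sym (ℕ.m∸n+n≡m (ℕ.<⇒≤ (j<q j<p)))) p∣q) p∣q∸j)

    -- j/(q-j) + 1 + q/j = q²/(j(q-j)), and both j and q-j are prime to p.
    j/[q∸j]≡-[1+q/j] : ∀ {j} → 0 < j → j < p →
      ν≥ (suc e ℕ.+ suc e) (fromℕ j * recipℕ (q ∸ j) + (1ℚ + fromℕ q * recipℕ j))
    j/[q∸j]≡-[1+q/j] {j} 0<j j<p =
      subst (ν≥ (suc e ℕ.+ suc e)) (sym expand)
        (ν≥-* (ν≥-* (ν≥-* (ν≥-recipℕ (p∤-small 0<j j<p)) (ν≥-recipℕ (p∤q∸j 0<j j<p))) νq) νq)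
      where
      instance
        j≢0 : NonZero j
        j≢0 = ℕ.>-nonZero 0<j
        q∸j≢0 : NonZero (q ∸ j)
        q∸j≢0 = ℕ.>-nonZero (ℕ.m<n⇒0<n∸m (j<q j<p))
      Q J a b : ℚ
      Q = fromℕ q
      J = fromℕ j
      a = recipℕ j
      b = recipℕ (q ∸ j)
      b[Q-J]≡1 : b * (Q - J) ≡ 1ℚ
      b[Q-J]≡1 = trans (cong (b *_) (sym (fromℕ-∸ (ℕ.<⇒≤ (j<q j<p))))) (recipℕ-inverseˡ (q ∸ j))
      expand : J * b + (1ℚ + Q * a) ≡ a * b * Q * Q
      expand = begin
        J * b + (1ℚ + Q * a)
          ≡⟨ identity Q J a b ⟩
        a * b * Q * Q + (1ℚ - b * (Q - J)) * (1ℚ + Q * a) + Q * b * (1ℚ - a * J)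
          ≡⟨ cong₂ (λ x y → a * b * Q * Q + (1ℚ - x) * (1ℚ + Q * a) + Q * b * (1ℚ - y)) b[Q-J]≡1 (recipℕ-inverseˡ j) ⟩
        a * b * Q * Q + (1ℚ - 1ℚ) * (1ℚ + Q * a) + Q * b * (1ℚ - 1ℚ)
          ≡⟨ vanish (a * b * Q * Q) (1ℚ + Q * a) (Q * b) ⟩
        a * b * Q * Q ∎
        where
        open ≡-Reasoning
        identity : ∀ Q J a b → J * b + (1ℚ + Q * a) ≡ a * b * Q * Q + (1ℚ - b * (Q - J)) * (1ℚ + Q * a) + Q * b * (1ℚ - a * J)
        identity = solve-∀ ℚ-ring
        vanish : ∀ x y z → x + (1ℚ - 1ℚ) * y + z * (1ℚ - 1ℚ) ≡ x
        vanish = solve-∀ ℚ-ring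

    1/C[q∸1,k]≡±[1+qHₖ] : ∀ {k} → k < p →
      ν≥ (suc e ℕ.+ suc e) (recipℕ ((q ∸ 1) C k) - -1^ k * (1ℚ + fromℕ q * harmonic k))
    1/C[q∸1,k]≡±[1+qHₖ] {zero}  _     = subst (ν≥ _) (sym (vanish (fromℕ q))) ν≥-0ℚ
      where
      vanish : ∀ Q → 1ℚ - 1ℚ * (1ℚ + Q * 0ℚ) ≡ 0ℚ
      vanish = solve-∀ ℚ-ring
    1/C[q∸1,k]≡±[1+qHₖ] {suc k} j<p =
      subst (ν≥ _) (sym step)
        (ν≥-- (ν≥-+ (ν≥-* (ν≥-* νJ νb) IH) (ν≥-* (ν≥-* νs (ν≥-+ (ν≥₀-fromℕ 1) (ν≥-* (ν≥₀-fromℕ q) νH))) νR))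
              (ν≥-* (ν≥-* (ν≥-* (ν≥-* νs νH) νa) νq) νq))
      where
      j = suc k
      k<p = ℕ.<-trans (ℕ.n<1+n k) j<p
      Q J a b s H u : ℚ
      Q = fromℕ q
      J = fromℕ j
      a = recipℕ j
      b = recipℕ (q ∸ j)
      s = -1^ k
      H = harmonic k
      u = recipℕ ((q ∸ 1) C k)
      IH = 1/C[q∸1,k]≡±[1+qHₖ] k<p
      νJ = ν≥₀-fromℕ j
      νa = ν≥-recipℕ (p∤-small (s≤s z≤n) j<p)
      νb = ν≥-recipℕ (p∤q∸j (s≤s z≤n) j<p)
      νs = ν≥--1^ k
      νH = ν≥-harmonic k<p
      νR = j/[q∸j]≡-[1+q/j] (s≤s z≤n) j<p
      recurrence : recipℕ ((q ∸ 1) C j) ≡ J * b * u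
      recurrence = trans (1/C[n,k+1]≡[k+1]/[n∸k]*1/C[n,k] (ℕ.<⇒≤pred (j<q j<p)))
                         (cong (λ d → J * recipℕ d * u) (ℕ.∸-+-assoc q 1 k))
      step : recipℕ ((q ∸ 1) C j) - - s * (1ℚ + Q * (H + a))
           ≡ J * b * (u - s * (1ℚ + Q * H)) + s * (1ℚ + Q * H) * (J * b + (1ℚ + Q * a)) - s * H * a * Q * Q
      step = trans (cong (λ v → v - - s * (1ℚ + Q * (H + a))) recurrence) (identity u s Q H a J b)
        where
        identity : ∀ u s Q H a J b → J * b * u - - s * (1ℚ + Q * (H + a))
                 ≡ J * b * (u - s * (1ℚ + Q * H)) + s * (1ℚ + Q * H) * (J * b + (1ℚ + Q * a)) - s * H * a * Q * Q
        identity = solve-∀ ℚ-ring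

    Σ1/C[q∸1,k]≡Σ±[1+qHₖ] : ∀ {n} → n < p →
      ν≥ (suc e ℕ.+ suc e) (sumFrom1 n (λ k → recipℕ ((q ∸ 1) C k)) - sumFrom1 n (λ k → -1^ k * (1ℚ + fromℕ q * harmonic k)))
    Σ1/C[q∸1,k]≡Σ±[1+qHₖ] {n} n<p = ν≥-sumFrom1-sub n _ _ (λ k _ k≤n → 1/C[q∸1,k]≡±[1+qHₖ] (ℕ.≤-<-trans k≤n n<p))

  1/±[1+ch]≡±[1-ch] : ∀ {m n x u s c h} → x * u ≡ 1ℚ → s * s ≡ 1ℚ →
    ν≥ 0 x → ν≥ 0 s → ν≥ n c → ν≥ 0 h → m ≤ n ℕ.+ n →
    ν≥ m (u - s * (1ℚ + c * h)) → ν≥ m (x - s * (1ℚ + - c * h))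
  1/±[1+ch]≡±[1-ch] {m} {n} {x} {u} {s} {c} {h} xu≡1 ss≡1 νx νs νc νh m≤2n νu =
    subst (ν≥ m) (sym expand)
      (ν≥-- (ν≥-weaken m≤2n (ν≥-* (ν≥-* (ν≥-* (ν≥-* (ν≥-* (ν≥-* νx νs) νs) νh) νh) νc) νc))
            (ν≥-* (ν≥-* (ν≥-* νx νs) ν1-ch) νu))
    where
    ν1-ch : ν≥ 0 (1ℚ + - c * h)
    ν1-ch = ν≥-+ (ν≥₀-fromℕ 1) (ν≥-* (ν≥-neg (ν≥-weaken z≤n νc)) νh)
    small main : ℚ
    small = x * s * s * h * h * c * c
    main  = x * s * (1ℚ + - c * h) * (u - s * (1ℚ + c * h))
    expand : x - s * (1ℚ + - c * h) ≡ small - main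
    expand = begin
      x - s * (1ℚ + - c * h)
        ≡⟨ identity x u s c h ⟩
      small - main + (x * (1ℚ - s * s) - s * (1ℚ + - c * h) * (1ℚ - x * u))
        ≡⟨ cong₂ (λ σ ι → small - main + (x * (1ℚ - σ) - s * (1ℚ + - c * h) * (1ℚ - ι))) ss≡1 xu≡1 ⟩
      small - main + (x * (1ℚ - 1ℚ) - s * (1ℚ + - c * h) * (1ℚ - 1ℚ))
        ≡⟨ vanish (small - main) x (s * (1ℚ + - c * h)) ⟩
      small - main ∎
      where
      open ≡-Reasoning
      identity : ∀ x u s c h → x - s * (1ℚ + - c * h)
        ≡ x * s * s * h * h * c * c - x * s * (1ℚ + - c * h) * (u - s * (1ℚ + c * h))
          + (x * (1ℚ - s * s) - s * (1ℚ + - c * h) * (1ℚ - x * u))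
      identity = solve-∀ ℚ-ring
      vanish : ∀ d y z → d + (y * (1ℚ - 1ℚ) - z * (1ℚ - 1ℚ)) ≡ d
      vanish = solve-∀ ℚ-ring

  C[p∸1,k]≡±[1-pHₖ] : ∀ {k} → k < p → ν≥ 2 (fromℕ ((p ∸ 1) C k) - -1^ k * (1ℚ + - fromℕ p * harmonic k))
  C[p∸1,k]≡±[1-pHₖ] {k} k<p =
    1/±[1+ch]≡±[1-ch] {2} {1} {fromℕ ((p ∸ 1) C k)} {recipℕ ((p ∸ 1) C k)} xu≡1 (-1^k*-1^k≡1 k)
      (ν≥₀-fromℕ ((p ∸ 1) C k)) (ν≥--1^ k) (ν≥-fromℕ p¹∣p) (ν≥-harmonic k<p) ℕ.≤-refl
      (1/C[q∸1,k]≡±[1+qHₖ] {p} {0} p¹∣p k<p)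
    where
    instance
      C≢0 : NonZero ((p ∸ 1) C k)
      C≢0 = ℕ.>-nonZero (nCk>0 (ℕ.<⇒≤pred k<p))
    p¹∣p : p ^ 1 ∣ p
    p¹∣p = ∣-reflexive (ℕ.*-identityʳ p)
    xu≡1 : fromℕ ((p ∸ 1) C k) * recipℕ ((p ∸ 1) C k) ≡ 1ℚ
    xu≡1 = trans (ℚ.*-comm (fromℕ ((p ∸ 1) C k)) (recipℕ ((p ∸ 1) C k))) (recipℕ-inverseˡ ((p ∸ 1) C k))

  ΣC[p∸1,k]≡Σ±[1-pHₖ] : ∀ {n} → n < p →
    ν≥ 2 (sumFrom1 n (λ k → fromℕ ((p ∸ 1) C k)) - sumFrom1 n (λ k → -1^ k * (1ℚ + - fromℕ p * harmonic k)))
  ΣC[p∸1,k]≡Σ±[1-pHₖ] {n} n<p = ν≥-sumFrom1-sub n _ _ (λ k _ k≤n → C[p∸1,k]≡±[1-pHₖ] (ℕ.≤-<-trans k≤n n<p))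

prime≥3⇒odd : ∀ {p} → Prime p → 3 ≤ p → ∃[ m ] p ≡ suc (2 ℕ.* m)
prime≥3⇒odd {p} p-prime 3≤p with p % 2 | m%n<n p 2 | m≡m%n+[m/n]*n p 2
... | 0           | _            | p≡[p/2]*2   = contradiction (composite 3≤p (divides (p / 2) p≡[p/2]*2)) (Prime.notComposite p-prime)
... | 1           | _            | p≡1+[p/2]*2 = p / 2 , trans p≡1+[p/2]*2 (cong suc (ℕ.*-comm (p / 2) 2))
... | suc (suc _) | s≤s (s≤s ()) | _

lemma2p4 : (p e : ℕ) → Prime p → 3 ≤ p → 1 ≤ e →
    sumFrom1 (p ∸ 1) (λ k → recipℕ ((p ^ e ∸ 1) C k))
      ≡ ((+ (p ^ (e ∸ 1))) // 1) * (1ℚ - ((+ (2 ^ (p ∸ 1))) // 1)) [modℚ p ^ suc e ]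
lemma2p4 _ zero    _       _   ()
lemma2p4 p (suc e) p-prime 3≤p _ with prime≥3⇒odd p-prime 3≤p
... | m , refl = inj₂ (ℤ∣.∣⇒∣ᵤ (numerator-divisible (subst (ν≥ (2 ℕ.+ e)) (sym rearrange)
                   (ν≥-+ (ν≥-weaken (s≤s (ℕ.m≤n+m (suc e) e)) (Σ1/C[q∸1,k]≡Σ±[1+qHₖ] ∣-refl N<p))
                         (ν≥-* (ΣC[p∸1,k]≡Σ±[1-pHₖ] N<p) (ν≥-fromℕ ∣-refl))))))
  where
  open PAdic p-prime
  N = 2 ℕ.* m
  N<p = ℕ.n<1+n N
  instance
    q≢0 : NonZero (suc N ^ suc e)
    q≢0 = ℕ.m^n≢0 (suc N) (suc e)
  P X Q : ℚ
  P = fromℕ (suc N)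
  X = fromℕ (suc N ^ e)
  Q = fromℕ (suc N ^ suc e)
  Σu ΣC T : ℚ
  Σu = sumFrom1 N (λ k → recipℕ ((suc N ^ suc e ∸ 1) C k))
  ΣC = sumFrom1 N (λ k → fromℕ (N C k))
  T  = sumFrom1 N (λ k → -1^ k * harmonic k)
  alternating : ℚ → ℚ
  alternating c = sumFrom1 N (λ k → -1^ k * (1ℚ + c * harmonic k))
  rearrange : Σu - X * (1ℚ - fromℕ (2 ^ N)) ≡ (Σu - alternating Q) + (ΣC - alternating (- P)) * X
  rearrange = begin
    Σu - X * (1ℚ - fromℕ (2 ^ N))              ≡⟨ cong (λ w → Σu - X * (1ℚ - w)) (binomialPrefix[n,n]≡2^n N) ⟨
    Σu - X * (1ℚ - (1ℚ + ΣC))                  ≡⟨ identity Σu X ΣC P T ⟩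
    (Σu - P * X * T) + (ΣC - - P * T) * X      ≡⟨ cong₂ (λ y z → (Σu - y) + (ΣC - z) * X)
                                                   (trans (cong (_* T) (sym (fromℕ-* (suc N) (suc N ^ e)))) (sym (sumFrom1-alternating Q harmonic m)))
                                                   (sym (sumFrom1-alternating (- P) harmonic m)) ⟩
    (Σu - alternating Q) + (ΣC - alternating (- P)) * X ∎
    where
    open ≡-Reasoning
    identity : ∀ U X S P T → U - X * (1ℚ - (1ℚ + S)) ≡ (U - P * X * T) + (S - - P * T) * X
    identity = solve-∀ ℚ-ring
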